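{- Let $\gamma,\gamma'$ be positive integers with $\gamma\ge2$. There exists an operad morphism $\varphi:\mathbf{CAs}^{(\gamma')}\to\mathbf{CAs}^{(\gamma)}$ if and only if $(\gamma-1)$ divides $(\gamma'-1)$.
   Context: A binary tree is either the leaf or an ordered pair of binary trees. $\mathbf{Mag}$ is the nonsymmetric set-theoretic operad of binary trees ($\mathbf{Mag}(n)$ = trees with $n$ leaves), with $\mathfrak{t}\circ_i\mathfrak{s}$ grafting the root of $\mathfrak{s}$ onto the $i$-th leaf of $\mathfrak{t}$. Combs: $\mathrm{LComb}_1=\mathrm{RComb}_1=(\text{leaf},\text{leaf})$, $\mathrm{LComb}_d=(\mathrm{LComb}_{d-1},\text{leaf})$, $\mathrm{RComb}_d=(\text{leaf},\mathrm{RComb}_{d-1})$. For $\gamma\ge1$, $\equiv_\gamma$ is the smallest operad congruence on $\mathbf{Mag}$ with $\mathrm{LComb}_\gamma\equiv_\gamma\mathrm{RComb}_\gamma$, and $\mathbf{CAs}^{(\gamma)}:=\mathbf{Mag}/_{\equiv_\gamma}$. An operad morphism is an arity-preserving map sending unit to unit and commuting with partial compositions. Divisibility is in $\mathbb{N}$ (every integer divides $0$). -}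

module Defs where

open import Data.Nat using (ℕ; zero; suc; _+_; _∸_; _<_)
open import Data.Nat.Properties using (_<?_)
open import Relation.Nullary using (yes; no)
open import Relation.Binary.PropositionalEquality using (_≡_)

data Tree : Set where
  leaf : Tree
  node : Tree → Tree → Tree

leaves : Tree → ℕ
leaves leaf       = 1
leaves (node l r) = leaves l + leaves r

-- Partial composition t ∘_i s with leaves indexed from 0 (i.e. the paper's
-- (i+1)-th leaf): graft the root of s onto leaf number i of t.
-- Only meaningful for i < leaves t (all uses below require this).
graft : Tree → ℕ → Tree → Tree
graft leaf       zero    s = s
graft leaf       (suc i) s = leaf
graft (node l r) i       s with i <? leaves l
... | yes _ = node (graft l i s) r
... | no  _ = node l (graft r (i ∸ leaves l) s)

LComb : ℕ → Tree
LComb zero    = leaf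
LComb (suc d) = node (LComb d) leaf

RComb : ℕ → Tree
RComb zero    = leaf
RComb (suc d) = node leaf (RComb d)

data _≈[_]_ : Tree → ℕ → Tree → Set where
  gen   : ∀ {γ} → LComb γ ≈[ γ ] RComb γ
  refl≈ : ∀ {γ t} → t ≈[ γ ] t
  sym≈  : ∀ {γ t u} → t ≈[ γ ] u → u ≈[ γ ] t
  trans≈ : ∀ {γ t u v} → t ≈[ γ ] u → u ≈[ γ ] v → t ≈[ γ ] v
  comp≈ : ∀ {γ t t′ s s′} (i : ℕ) → i < leaves t →
          t ≈[ γ ] t′ → s ≈[ γ ] s′ → graft t i s ≈[ γ ] graft t′ i s′

-- An operad morphism CAs^(γ′) → CAs^(γ), i.e. Mag/≡γ′ → Mag/≡γ, presented
-- on representatives: a map of trees respecting the congruences (hence a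
-- well-defined map of quotients), arity-preserving, unit-preserving and
-- commuting with partial compositions (modulo ≡γ).
record OperadMorphism (γ′ γ : ℕ) : Set where
  field
    map       : Tree → Tree
    respects  : ∀ {t u} → t ≈[ γ′ ] u → map t ≈[ γ ] map u
    arity     : ∀ t → leaves (map t) ≡ leaves t
    unit      : map leaf ≈[ γ ] leaf
    compose   : ∀ t i s → i < leaves t →
                map (graft t i s) ≈[ γ ] graft (map t) i (map s)

-- A morphism CAs^(γ′) → CAs^(γ) must be the identity on representatives, since it preserves
-- arity and so fixes the unique binary tree, which generates Mag. It therefore exists iff
-- LComb γ′ ≡γ RComb γ′. The depth of the leftmost leaf modulo γ − 1 is invariant under ≡γ
-- (the generator changes it from γ to 1), which forces (γ − 1) ∣ (γ′ − 1). Conversely,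
-- grafting the relation LComb γ ≡γ RComb γ once on the left and once on the right of a comb
-- relation of size N gives the comb relation of size N + γ − 1.
module Submission where

open import Defs
open import Data.Nat using (ℕ; _≤_; _∸_)
open import Data.Nat.Divisibility using (_∣_)
open import Function.Bundles using (_⇔_)

open import Data.Nat using (zero; suc; _+_; _*_; _<_; _%_; z≤n; s≤s; NonZero)
open import Data.Nat.Properties
open import Data.Nat.DivMod using (%-distribˡ-+; [m+n]%n≡m%n; n%n≡0)
open import Data.Nat.Divisibility using (divides; m%n≡0⇒n∣m)
open import Data.Empty using (⊥-elim)
open import Function.Bundles using (mk⇔)
open import Function.Construct.Composition using (_⇔-∘_)
open import Relation.Binary.Bundles using (Setoid)
open import Relation.Nullary using (yes; no)
open import Relation.Binary.PropositionalEquality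
  using (_≡_; refl; sym; trans; cong; cong₂; subst; subst₂; module ≡-Reasoning)

0<leaves : ∀ t → 0 < leaves t
0<leaves leaf       = s≤s z≤n
0<leaves (node l r) = ≤-trans (0<leaves l) (m≤m+n (leaves l) (leaves r))

2≤leaves-node : ∀ l r → 2 ≤ leaves (node l r)
2≤leaves-node l r = +-mono-≤ (0<leaves l) (0<leaves r)

leaves≡2⇒cherry : ∀ t → leaves t ≡ 2 → t ≡ node leaf leaf
leaves≡2⇒cherry leaf ()
leaves≡2⇒cherry (node leaf leaf) _ = refl
leaves≡2⇒cherry (node leaf (node a b)) e
  with subst (2 ≤_) (suc-injective e) (2≤leaves-node a b)
... | s≤s ()
leaves≡2⇒cherry (node (node a b) r) e
  with subst (3 ≤_) e (+-mono-≤ (2≤leaves-node a b) (0<leaves r))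
... | s≤s (s≤s ())

graft-node-< : ∀ l r {i} s → i < leaves l → graft (node l r) i s ≡ node (graft l i s) r
graft-node-< l r {i} s i<l with i <? leaves l
... | yes _   = refl
... | no  i≮l = ⊥-elim (i≮l i<l)

graft-node-+ : ∀ l r i s → graft (node l r) (leaves l + i) s ≡ node l (graft r i s)
graft-node-+ l r i s with leaves l + i <? leaves l
... | yes l+i<l = ⊥-elim (m+n≮m (leaves l) i l+i<l)
... | no  _     = cong (λ j → node l (graft r j s)) (m+n∸m≡n (leaves l) i)

≈-setoid : ℕ → Setoid _ _
≈-setoid γ = record
  { Carrier       = Tree
  ; _≈_           = _≈[ γ ]_
  ; isEquivalence = record { refl = refl≈ ; sym = sym≈ ; trans = trans≈ }
  }

node-cong : ∀ {γ a a′ b b′} → a ≈[ γ ] a′ → b ≈[ γ ] b′ → node a b ≈[ γ ] node a′ b′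
node-cong {γ} {a} {a′} {b} {b′} a≈a′ b≈b′ = begin
  node a b                                  ≡⟨ graft-node-< leaf b a (s≤s z≤n) ⟨
  graft (node leaf b) 0 a                   ≈⟨ comp≈ {t = node leaf b} 0 (s≤s z≤n) refl≈ a≈a′ ⟩
  graft (node leaf b) 0 a′                  ≡⟨ graft-node-< leaf b a′ (s≤s z≤n) ⟩
  node a′ b                                 ≡⟨ graft-node-+ a′ leaf 0 b ⟨
  graft (node a′ leaf) (leaves a′ + 0) b    ≈⟨ comp≈ {t = node a′ leaf} _ last-leaf refl≈ b≈b′ ⟩
  graft (node a′ leaf) (leaves a′ + 0) b′   ≡⟨ graft-node-+ a′ leaf 0 b′ ⟩
  node a′ b′                                ∎
  where
    open import Relation.Binary.Reasoning.Setoid (≈-setoid γ)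
    last-leaf : leaves a′ + 0 < leaves a′ + 1
    last-leaf = +-monoʳ-< (leaves a′) (s≤s z≤n)

⊆-closure : ∀ {γ γ′} → LComb γ′ ≈[ γ ] RComb γ′ →
            ∀ {t u} → t ≈[ γ′ ] u → t ≈[ γ ] u
⊆-closure combs gen                = combs
⊆-closure combs refl≈              = refl≈
⊆-closure combs (sym≈ p)           = sym≈ (⊆-closure combs p)
⊆-closure combs (trans≈ p q)       = trans≈ (⊆-closure combs p) (⊆-closure combs q)
⊆-closure combs (comp≈ i i<t p q)  = comp≈ i i<t (⊆-closure combs p) (⊆-closure combs q)

module _ {γ′ γ : ℕ} (φ : OperadMorphism γ′ γ) where
  open OperadMorphism φ

  map-cherry : map (node leaf leaf) ≡ node leaf leaf
  map-cherry = leaves≡2⇒cherry _ (arity (node leaf leaf))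

  -- Every tree node l r is obtained by grafting l and r onto the cherry.
  map≈id : ∀ t → map t ≈[ γ ] t
  map≈id leaf       = unit
  map≈id (node l r) =
    trans≈ (compose (node leaf r) 0 l (s≤s z≤n))
      (trans≈ (comp≈ 0 0<map-leaf-r map-leaf-r refl≈) (node-cong (map≈id l) (map≈id r)))
    where
      0<map-leaf-r : 0 < leaves (map (node leaf r))
      0<map-leaf-r = subst (0 <_) (sym (arity (node leaf r))) (s≤s z≤n)
      map-leaf-r : map (node leaf r) ≈[ γ ] node leaf (map r)
      map-leaf-r = subst (λ c → map (node leaf r) ≈[ γ ] graft c 1 (map r)) map-cherry
                     (compose (node leaf leaf) 1 r (s≤s (s≤s z≤n)))

  morphism⇒combs≈ : LComb γ′ ≈[ γ ] RComb γ′
  morphism⇒combs≈ = trans≈ (sym≈ (map≈id _)) (trans≈ (respects gen) (map≈id _))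

combs≈⇒morphism : ∀ {γ′ γ} → LComb γ′ ≈[ γ ] RComb γ′ → OperadMorphism γ′ γ
combs≈⇒morphism combs = record
  { map      = λ t → t
  ; respects = ⊆-closure combs
  ; arity    = λ _ → refl
  ; unit     = refl≈
  ; compose  = λ _ _ _ _ → refl≈
  }

morphism⇔combs≈ : ∀ {γ′ γ} → OperadMorphism γ′ γ ⇔ LComb γ′ ≈[ γ ] RComb γ′
morphism⇔combs≈ = mk⇔ morphism⇒combs≈ combs≈⇒morphism

leftDepth : Tree → ℕ
leftDepth leaf       = 0
leftDepth (node l r) = suc (leftDepth l)

leftDepth-LComb : ∀ n → leftDepth (LComb n) ≡ n
leftDepth-LComb zero    = refl
leftDepth-LComb (suc n) = cong suc (leftDepth-LComb n)

leftDepth-graft-zero : ∀ t s → leftDepth (graft t 0 s) ≡ leftDepth t + leftDepth s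
leftDepth-graft-zero leaf       s = refl
leftDepth-graft-zero (node l r) s
  rewrite graft-node-< l r s (0<leaves l) = cong suc (leftDepth-graft-zero l s)

leftDepth-graft-suc : ∀ t i s → leftDepth (graft t (suc i) s) ≡ leftDepth t
leftDepth-graft-suc leaf       i s = refl
leftDepth-graft-suc (node l r) i s with suc i <? leaves l
... | yes _ = cong suc (leftDepth-graft-suc l i s)
... | no  _ = refl

module _ (n : ℕ) .{{_ : NonZero n}} where

  %-cong-+ : ∀ {m m′ o o′} → m % n ≡ m′ % n → o % n ≡ o′ % n → (m + o) % n ≡ (m′ + o′) % n
  %-cong-+ {m} {m′} {o} {o′} m≡m′ o≡o′ = begin
    (m + o) % n               ≡⟨ %-distribˡ-+ m o n ⟩
    (m % n + o % n) % n       ≡⟨ cong₂ (λ x y → (x + y) % n) m≡m′ o≡o′ ⟩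
    (m′ % n + o′ % n) % n     ≡⟨ %-distribˡ-+ m′ o′ n ⟨
    (m′ + o′) % n             ∎
    where open ≡-Reasoning

  leftDepth-%-invariant : ∀ {t u} → t ≈[ suc n ] u → leftDepth t % n ≡ leftDepth u % n
  leftDepth-%-invariant gen =
    trans (cong (_% n) (leftDepth-LComb (suc n))) ([m+n]%n≡m%n 1 n)
  leftDepth-%-invariant refl≈        = refl
  leftDepth-%-invariant (sym≈ p)     = sym (leftDepth-%-invariant p)
  leftDepth-%-invariant (trans≈ p q) = trans (leftDepth-%-invariant p) (leftDepth-%-invariant q)
  leftDepth-%-invariant (comp≈ {t = t} {t′} {s} {s′} zero _ p q) =
    subst₂ (λ x y → x % n ≡ y % n)
      (sym (leftDepth-graft-zero t s)) (sym (leftDepth-graft-zero t′ s′))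
      (%-cong-+ (leftDepth-%-invariant p) (leftDepth-%-invariant q))
  leftDepth-%-invariant (comp≈ {t = t} {t′} {s} {s′} (suc i) _ p _) =
    subst₂ (λ x y → x % n ≡ y % n)
      (sym (leftDepth-graft-suc t i s)) (sym (leftDepth-graft-suc t′ i s′))
      (leftDepth-%-invariant p)

combs≈⇒∣ : ∀ k p → LComb (suc p) ≈[ suc (suc k) ] RComb (suc p) → suc k ∣ p
combs≈⇒∣ k p combs = m%n≡0⇒n∣m p n (begin
  p % n               ≡⟨ [m+n]%n≡m%n p n ⟨
  (p + n) % n         ≡⟨ cong (_% n) (+-suc p k) ⟩
  (suc p + k) % n     ≡⟨ %-cong-+ n {suc p} {1} {k} suc-p≡1 refl ⟩
  n % n               ≡⟨ n%n≡0 n ⟩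
  0                   ∎)
  where
    open ≡-Reasoning
    n = suc k
    suc-p≡1 : suc p % n ≡ 1 % n
    suc-p≡1 = trans (cong (_% n) (sym (leftDepth-LComb (suc p))))
                    (leftDepth-%-invariant n combs)

leaves-LComb : ∀ n → leaves (LComb n) ≡ suc n
leaves-LComb zero    = refl
leaves-LComb (suc n) = trans (cong (_+ 1) (leaves-LComb n)) (cong suc (+-comm n 1))

graft-LComb : ∀ a b → graft (LComb a) 0 (LComb b) ≡ LComb (a + b)
graft-LComb zero    b = refl
graft-LComb (suc a) b =
  trans (graft-node-< (LComb a) leaf (LComb b) (0<leaves (LComb a)))
        (cong (λ t → node t leaf) (graft-LComb a b))

graft-RComb : ∀ a b → graft (RComb a) a (RComb b) ≡ RComb (a + b)
graft-RComb zero    b = refl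
graft-RComb (suc a) b =
  trans (graft-node-+ leaf (RComb a) a (RComb b)) (cong (node leaf) (graft-RComb a b))

graft-LComb-last : ∀ n s → graft (LComb (suc n)) (suc n) s ≡ node (LComb n) s
graft-LComb-last n s =
  subst (λ i → graft (LComb (suc n)) i s ≡ node (LComb n) s)
    (trans (+-identityʳ _) (leaves-LComb n)) (graft-node-+ (LComb n) leaf 0 s)

module _ {m : ℕ} where
  open import Relation.Binary.Reasoning.Setoid (≈-setoid (suc m))

  combs≈-step : ∀ N → LComb (suc N) ≈[ suc m ] RComb (suc N) →
                LComb (suc (m + N)) ≈[ suc m ] RComb (suc (m + N))
  combs≈-step N combs = begin
    LComb (suc m + N)                          ≡⟨ graft-LComb (suc m) N ⟨
    graft (LComb (suc m)) 0 (LComb N)          ≈⟨ comp≈ 0 (0<leaves (LComb (suc m))) gen refl≈ ⟩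
    graft (RComb (suc m)) 0 (LComb N)          ≡⟨ graft-node-< leaf (RComb m) (LComb N) (s≤s z≤n) ⟩
    node (LComb N) (RComb m)                   ≡⟨ graft-LComb-last N (RComb m) ⟨
    graft (LComb (suc N)) (suc N) (RComb m)    ≈⟨ comp≈ (suc N) last-leaf combs refl≈ ⟩
    graft (RComb (suc N)) (suc N) (RComb m)    ≡⟨ graft-RComb (suc N) m ⟩
    RComb (suc (N + m))                        ≡⟨ cong (λ j → RComb (suc j)) (+-comm N m) ⟩
    RComb (suc (m + N))                        ∎
    where
      last-leaf : suc N < leaves (LComb (suc N))
      last-leaf = subst (suc N <_) (sym (leaves-LComb (suc N))) (n<1+n (suc N))

  combs≈-multiple : ∀ q → LComb (suc (q * m)) ≈[ suc m ] RComb (suc (q * m))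
  combs≈-multiple zero    = refl≈
  combs≈-multiple (suc q) = combs≈-step (q * m) (combs≈-multiple q)

∣⇒combs≈ : ∀ {m p} → m ∣ p → LComb (suc p) ≈[ suc m ] RComb (suc p)
∣⇒combs≈ (divides q refl) = combs≈-multiple q

proposition3p2p7 : (γ γ′ : ℕ) → 1 ≤ γ′ → 2 ≤ γ →
    OperadMorphism γ′ γ ⇔ ((γ ∸ 1) ∣ (γ′ ∸ 1))
proposition3p2p7 (suc (suc k)) (suc p) (s≤s z≤n) (s≤s (s≤s z≤n)) =
  mk⇔ (combs≈⇒∣ k p) ∣⇒combs≈ ⇔-∘ morphism⇔combs≈
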